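{- Every $d$-dimensional $\Pi$-zonotope $Z$ is combinatorially equivalent to a $\Pi$-zonotope $Z(V')$ with $V'\subseteq V(d)$ whose graph is connected and has $d+1$ vertices.
   Context: For $n\ge1$ let $\mathbf e_1,\dots,\mathbf e_{n+1}$ be the standard basis of $\mathbb R^{n+1}$, $\mathbf e_{ij}=\mathbf e_i-\mathbf e_j$, $V(n)=\{\mathbf e_{ij}:1\le i<j\le n+1\}$. A $\Pi$-zonotope is a zonotope $Z(V)=\sum_{\mathbf v\in V}[\mathbf 0,\mathbf v]$ with $V\subseteq V(n)$ for some $n$; its graph has vertices $1,\dots,n+1$ and an edge $\{i,j\}$ iff $\pm\mathbf e_{ij}\in V$. -}

module Defs where

open import Data.Nat using (ℕ; zero; suc)
open import Data.Fin using (Fin; _<_; _≟_)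
open import Data.Integer using (ℤ; +_; _+_; _-_; _*_) renaming (_<_ to _<ℤ_; _≤_ to _≤ℤ_)
open import Data.Vec using (Vec; tabulate; zipWith; replicate; foldr)
open import Data.List using (List; []; _∷_; map; length; concatMap)
open import Data.List.Membership.Propositional using (_∈_)
open import Data.List.Relation.Unary.All using (All)
open import Data.List.Relation.Unary.Unique.Propositional using (Unique)
open import Data.List.Relation.Binary.Sublist.Propositional using (_⊆_)
open import Data.Product using (Σ; ∃; _×_; _,_)
open import Data.Sum using (_⊎_)
open import Relation.Nullary using (¬_; yes; no)
open import Relation.Binary.PropositionalEquality using (_≡_; _≢_)

Pt : ℕ → Set
Pt n = Vec ℤ (suc n)

-- An element of V(n) is encoded by the pair (i , j) with i < j, standing for e_i - e_j.
Pair : ℕ → Set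
Pair n = Fin (suc n) × Fin (suc n)

δ : ∀ {n} → Fin n → Fin n → ℤ
δ i k with i ≟ k
... | yes _ = + 1
... | no  _ = + 0

vec : ∀ {n} → Pair n → Pt n
vec (i , j) = tabulate (λ k → δ i k - δ j k)

record GenSet (n : ℕ) : Set where
  constructor genSet
  field
    gens    : List (Pair n)
    ordered : All (λ p → Data.Product.proj₁ p < Data.Product.proj₂ p) gens
    unique  : Unique gens
open GenSet public

zeroPt : ∀ {n} → Pt n
zeroPt = replicate _ (+ 0)

_⊕_ : ∀ {n} → Pt n → Pt n → Pt n
_⊕_ = zipWith _+_

dot : ∀ {n} → Pt n → Pt n → ℤ
dot c p = foldr _ _+_ (+ 0) (zipWith _*_ c p)

subs : ∀ {A : Set} → List A → List (List A)
subs []       = [] ∷ []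
subs (x ∷ xs) = concatMap (λ s → s ∷ (x ∷ s) ∷ []) (subs xs)

sumVecs : ∀ {n} → List (Pt n) → Pt n
sumVecs []       = zeroPt
sumVecs (v ∷ vs) = v ⊕ sumVecs vs

-- The finite set of subset sums  { Σ_{v ∈ S} v : S ⊆ V };  Z(V) is its convex hull.
SubsetSums : ∀ {n} → GenSet n → List (Pt n)
SubsetSums V = map sumVecs (subs (map vec (gens V)))

-- x is a vertex of Z(V): x is the unique maximiser over Z(V) of some linear
-- functional c (integer functionals suffice as Z(V) is a lattice polytope;
-- maximising over Z(V) = conv(SubsetSums V) is the same as over SubsetSums V).
IsVertex : ∀ {n} → GenSet n → Pt n → Set
IsVertex V x = x ∈ SubsetSums V ×
  ∃ λ c → ∀ p → p ∈ SubsetSums V → p ≢ x → dot c p <ℤ dot c x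

InFace : ∀ {n} → GenSet n → Pt n → Pt n → Set
InFace V c x = IsVertex V x × (∀ p → p ∈ SubsetSums V → dot c p ≤ℤ dot c x)

-- Combinatorial equivalence: a bijection between vertex sets that maps the
-- family of vertex sets of faces onto the family of vertex sets of faces
-- (equivalently, an isomorphism of face lattices).
CombEquiv : ∀ {n m} → GenSet n → GenSet m → Set
CombEquiv {n} {m} V W =
  Σ (Pt n → Pt m) λ f → Σ (Pt m → Pt n) λ g →
    (∀ x → IsVertex V x → IsVertex W (f x) × g (f x) ≡ x) ×
    (∀ y → IsVertex W y → IsVertex V (g y) × f (g y) ≡ y) ×
    (∀ c → ∃ λ c' → ∀ x → IsVertex V x → (InFace V c x → InFace W c' (f x)) × (InFace W c' (f x) → InFace V c x)) ×
    (∀ c' → ∃ λ c → ∀ y → IsVertex W y → (InFace W c' y → InFace V c (g y)) × (InFace V c (g y) → InFace W c' y))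

-- Linear independence of a list of integer vectors (over ℤ, equivalently over ℚ or ℝ).
lincomb : ∀ {n} → (vs : List (Pt n)) → Vec ℤ (length vs) → Pt n
lincomb []       _                    = zeroPt
lincomb (v ∷ vs) (Data.Vec._∷_ a as) = Data.Vec.map (a *_) v ⊕ lincomb vs as

LinIndep : ∀ {n} → List (Pt n) → Set
LinIndep vs = ∀ λs → lincomb vs λs ≡ zeroPt → λs ≡ replicate _ (+ 0)

-- dim Z(V) = dim lin(V) = rank of V = d
HasDim : ∀ {n} → GenSet n → ℕ → Set
HasDim V d =
  (∃ λ L → L ⊆ map vec (gens V) × length L ≡ d × LinIndep L) ×
  (∀ L → L ⊆ map vec (gens V) → length L ≡ suc d → ¬ LinIndep L)

-- Graph of V: vertices Fin (suc n), edge {i,j} iff e_ij ∈ V (i<j).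
data Reach {n} (V : GenSet n) : Fin (suc n) → Fin (suc n) → Set where
  here  : ∀ {i} → Reach V i i
  stepF : ∀ {i j k} → (i , j) ∈ gens V → Reach V j k → Reach V i k
  stepB : ∀ {i j k} → (j , i) ∈ gens V → Reach V j k → Reach V i k

Connected : ∀ {n} → GenSet n → Set
Connected {n} V = ∀ i j → Reach V i j

{-# OPTIONS --safe #-}
-- If the graph of V is disconnected, take consecutive vertices k and k + 1 lying in different
-- unions C of components and identify the coordinates k and k + 1.  The span of V is
-- orthogonal to the indicator vector of C while the kernel of the identification, spanned by
-- e_k − e_(k+1), is not; so the identification is injective on the span, keeps the rank, and
-- every linear functional on either side is matched by one on the other side that agrees on
-- all subset sums, whence vertices and faces correspond.  After finitely many merges the
-- graph is connected.  A connected graph on n + 1 vertices has a spanning tree, whose n edge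
-- vectors are independent, and all generators lie in the hyperplane of coordinate sum 0, so
-- then n = d.
module Submission where

open import Defs
open import Data.Bool using (Bool; true; false; if_then_else_; _∨_)
import Data.Bool.Properties as Boolₚ
open import Data.Empty using (⊥-elim)
open import Data.Fin as Fin using (Fin; zero; suc; pinch; inject₁)
import Data.Fin.Properties as Finₚ
open import Data.Integer as ℤ using (ℤ; +_; -[1+_]; _+_; _-_; _*_; -_)
import Data.Integer.Properties as ℤₚ
open import Data.Integer.Tactic.RingSolver using (solve-∀)
open import Data.List as List using (List; []; _∷_; length; _++_)
import Data.List.Properties as Listₚ
open import Data.List.Membership.Propositional using (_∈_; find)
open import Data.List.Membership.Propositional.Properties using (∈-map⁺; ∈-map⁻; ∈-∃++)
open import Data.List.Relation.Unary.Any using (here; there)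
open import Data.List.Relation.Unary.All as All using (All; []; _∷_)
import Data.List.Relation.Unary.All.Properties as Allₚ
open import Data.List.Relation.Binary.Sublist.Propositional as Sublist using (_⊆_; []; _∷ʳ_; _∷_)
import Data.List.Relation.Binary.Sublist.Propositional.Properties as Sublistₚ
open import Data.List.Relation.Unary.AllPairs using ([]; _∷_)
open import Data.List.Relation.Unary.Unique.Propositional using (Unique)
open import Data.Nat as ℕ using (ℕ; zero; suc; _≤_; s≤s; z≤n)
import Data.Nat.Properties as ℕₚ
open import Data.Product using (Σ; ∃; _×_; _,_; proj₁; proj₂)
open import Data.Sum using (_⊎_; inj₁; inj₂)
open import Data.Vec as Vec using (Vec; []; _∷_; lookup; replicate; tabulate; zipWith)
import Data.Vec.Properties as Vecₚ
open import Function using (_∘_)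
open import Relation.Nullary using (¬_; yes; no; does)
open import Relation.Binary.PropositionalEquality

length-insert : ∀ {A : Set} (As : List A) {y Bs} → length (As ++ y ∷ Bs) ≡ suc (length (As ++ Bs))
length-insert [] = refl
length-insert (a ∷ As) = cong suc (length-insert As)

∈-insert⁻ : ∀ {A : Set} (As : List A) {y Bs x} → x ∈ As ++ y ∷ Bs → x ∈ As ++ Bs ⊎ x ≡ y
∈-insert⁻ [] (here x≡y) = inj₂ x≡y
∈-insert⁻ [] (there x∈) = inj₁ x∈
∈-insert⁻ (a ∷ As) (here x≡a) = inj₁ (here x≡a)
∈-insert⁻ (a ∷ As) (there x∈) with ∈-insert⁻ As x∈
... | inj₁ x∈′ = inj₁ (there x∈′)
... | inj₂ x≡y = inj₂ x≡y

insert-⊆ : ∀ {A : Set} {T G : List A} {y} → T ⊆ G → y ∈ G → ¬ (y ∈ T) →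
  ∃ λ As → ∃ λ Bs → T ≡ As ++ Bs × As ++ y ∷ Bs ⊆ G
insert-⊆ (x ∷ʳ T⊆) (here refl) y∉T = [] , _ , refl , refl ∷ T⊆
insert-⊆ (x ∷ʳ T⊆) (there y∈) y∉T with insert-⊆ T⊆ y∈ y∉T
... | As , Bs , refl , ⊆G = As , Bs , refl , x ∷ʳ ⊆G
insert-⊆ (refl ∷ T⊆) (here refl) y∉T = ⊥-elim (y∉T (here refl))
insert-⊆ (refl ∷ T⊆) (there y∈) y∉T with insert-⊆ T⊆ y∈ (λ y∈T → y∉T (there y∈T))
... | As , Bs , refl , ⊆G = _ ∷ As , Bs , refl , refl ∷ ⊆G

⊆-map⁻ : ∀ {A B : Set} (g : A → B) (Ms : List A) {Ks} → Ks ⊆ List.map g Ms → ∃ λ Ls → Ls ⊆ Ms × Ks ≡ List.map g Ls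
⊆-map⁻ g [] [] = [] , [] , refl
⊆-map⁻ g (x ∷ Ms) (_ ∷ʳ Ks⊆) with ⊆-map⁻ g Ms Ks⊆
... | Ls , Ls⊆ , refl = Ls , x ∷ʳ Ls⊆ , refl
⊆-map⁻ g (x ∷ Ms) (refl ∷ Ks⊆) with ⊆-map⁻ g Ms Ks⊆
... | Ls , Ls⊆ , refl = x ∷ Ls , refl ∷ Ls⊆ , refl

Unique-map⁺ : ∀ {A B : Set} (f : A → B) (xs : List A) → Unique xs →
  (∀ {x y} → x ∈ xs → y ∈ xs → f x ≡ f y → x ≡ y) → Unique (List.map f xs)
Unique-map⁺ f [] [] _ = []
Unique-map⁺ f (x ∷ xs) (x≢xs ∷ unique) injective =
  Allₚ.map⁺ (All.tabulate (λ y∈ fx≡fy → All.lookup x≢xs y∈ (injective (here refl) (there y∈) fx≡fy))) ∷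
  Unique-map⁺ f xs unique (λ x∈ y∈ → injective (there x∈) (there y∈))

subs-map : ∀ {A B : Set} (g : A → B) (xs : List A) → subs (List.map g xs) ≡ List.map (List.map g) (subs xs)
subs-map g [] = refl
subs-map g (x ∷ xs) rewrite subs-map g xs = step (subs xs)
  where
  step : ∀ ss → List.concatMap (λ s → s ∷ (g x ∷ s) ∷ []) (List.map (List.map g) ss) ≡
                List.map (List.map g) (List.concatMap (λ s → s ∷ (x ∷ s) ∷ []) ss)
  step [] = refl
  step (s ∷ ss) = cong (λ t → List.map g s ∷ (g x ∷ List.map g s) ∷ t) (step ss)

∈-subs : ∀ {A : Set} (xs : List A) {S} → S ∈ subs xs → ∀ {v} → v ∈ S → v ∈ xs
∈-subs [] (here refl) ()
∈-subs (x ∷ xs) {S} S∈ = go (subs xs) S∈ (∈-subs xs)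
  where
  go : ∀ ss → S ∈ List.concatMap (λ s → s ∷ (x ∷ s) ∷ []) ss →
    (∀ {T} → T ∈ ss → ∀ {v} → v ∈ T → v ∈ xs) → ∀ {v} → v ∈ S → v ∈ x ∷ xs
  go (s ∷ ss) (here refl) IH v∈ = there (IH (here refl) v∈)
  go (s ∷ ss) (there (here refl)) IH (here refl) = here refl
  go (s ∷ ss) (there (here refl)) IH (there v∈) = there (IH (here refl) v∈)
  go (s ∷ ss) (there (there S∈)) IH v∈ = go ss S∈ (λ T∈ → IH (there T∈)) v∈

count : ∀ {m} → (Fin m → Bool) → ℕ
count {zero} f = 0
count {suc m} f = (if f zero then 1 else 0) ℕ.+ count (λ v → f (suc v))

count-≤ : ∀ {m} (f : Fin m → Bool) → count f ≤ m
count-≤ {zero} f = z≤n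
count-≤ {suc m} f with f zero
... | true = s≤s (count-≤ (λ v → f (suc v)))
... | false = ℕₚ.m≤n⇒m≤1+n (count-≤ (λ v → f (suc v)))

count-all : ∀ {m} (f : Fin m → Bool) → (∀ v → f v ≡ true) → count f ≡ m
count-all {zero} f all = refl
count-all {suc m} f all rewrite all zero = cong suc (count-all (λ v → f (suc v)) (λ v → all (suc v)))

count-none : ∀ m → count {m} (λ _ → false) ≡ 0
count-none zero = refl
count-none (suc m) = count-none m

count-cong : ∀ {m} {f g : Fin m → Bool} → (∀ v → f v ≡ g v) → count f ≡ count g
count-cong {zero} f≗g = refl
count-cong {suc m} f≗g = cong₂ (λ b c → (if b then 1 else 0) ℕ.+ c) (f≗g zero) (count-cong (λ v → f≗g (suc v)))

count-insert : ∀ {m} (f g : Fin m → Bool) w → f w ≡ false → g w ≡ true → (∀ v → v ≢ w → g v ≡ f v) →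
  count g ≡ suc (count f)
count-insert {suc m} f g zero fw gw elsewhere rewrite fw | gw =
  cong suc (count-cong (λ v → elsewhere (suc v) (λ ())))
count-insert {suc m} f g (suc w) fw gw elsewhere rewrite elsewhere zero (λ ()) =
  trans (cong ((if f zero then 1 else 0) ℕ.+_)
          (count-insert (λ v → f (suc v)) (λ v → g (suc v)) w fw gw
            (λ v v≢w → elsewhere (suc v) (λ eq → v≢w (Finₚ.suc-injective eq)))))
        (ℕₚ.+-suc (if f zero then 1 else 0) _)

full-or-boundary : ∀ {n} (S : Fin (suc n) → Bool) → S zero ≡ true →
  (∀ v → S v ≡ true) ⊎ ∃ λ (k : Fin n) → S (inject₁ k) ≡ true × S (suc k) ≡ false
full-or-boundary {zero} S 0∈S = inj₁ λ { zero → 0∈S }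
full-or-boundary {suc n} S 0∈S with S (suc zero) in 1∈S
... | false = inj₂ (zero , 0∈S , 1∈S)
... | true with full-or-boundary (λ v → S (suc v)) 1∈S
...   | inj₁ full = inj₁ λ { zero → 0∈S ; (suc v) → full v }
...   | inj₂ (k , k∈S , k+1∉S) = inj₂ (suc k , k∈S , k+1∉S)

infixl 6 _+ᵛ_ _-ᵛ_
infixl 7 _*ᵛ_
infix 8 _∙_

0ᵛ : ∀ m → Vec ℤ m
0ᵛ m = replicate m (+ 0)

1ᵛ : ∀ m → Vec ℤ m
1ᵛ m = replicate m (+ 1)

_+ᵛ_ _-ᵛ_ : ∀ {m} → Vec ℤ m → Vec ℤ m → Vec ℤ m
_+ᵛ_ = zipWith _+_
_-ᵛ_ = zipWith _-_

_*ᵛ_ : ∀ {m} → ℤ → Vec ℤ m → Vec ℤ m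
a *ᵛ v = Vec.map (a *_) v

-- On Pt n, _∙_, _+ᵛ_ and 0ᵛ (suc n) coincide definitionally with dot, _⊕_ and zeroPt.
_∙_ : ∀ {m} → Vec ℤ m → Vec ℤ m → ℤ
c ∙ p = Vec.foldr _ _+_ (+ 0) (zipWith _*_ c p)

vec-ext : ∀ {m} {x y : Vec ℤ m} → (∀ i → lookup x i ≡ lookup y i) → x ≡ y
vec-ext {x = x} {y} h =
  trans (sym (Vecₚ.tabulate∘lookup x)) (trans (Vecₚ.tabulate-cong h) (Vecₚ.tabulate∘lookup y))

∙-distribʳ-+ᵛ : ∀ {m} (c x y : Vec ℤ m) → c ∙ (x +ᵛ y) ≡ c ∙ x + c ∙ y
∙-distribʳ-+ᵛ [] [] [] = refl
∙-distribʳ-+ᵛ (a ∷ c) (x ∷ xs) (y ∷ ys) rewrite ∙-distribʳ-+ᵛ c xs ys = ring a x y (c ∙ xs) (c ∙ ys)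
  where
  ring : ∀ a x y u v → a * (x + y) + (u + v) ≡ a * x + u + (a * y + v)
  ring = solve-∀

∙-distribʳ-subᵛ : ∀ {m} (c x y : Vec ℤ m) → c ∙ (x -ᵛ y) ≡ c ∙ x - c ∙ y
∙-distribʳ-subᵛ [] [] [] = refl
∙-distribʳ-subᵛ (a ∷ c) (x ∷ xs) (y ∷ ys) rewrite ∙-distribʳ-subᵛ c xs ys = ring a x y (c ∙ xs) (c ∙ ys)
  where
  ring : ∀ a x y u v → a * (x - y) + (u - v) ≡ a * x + u - (a * y + v)
  ring = solve-∀

∙-distribˡ-+ᵛ : ∀ {m} (a b p : Vec ℤ m) → (a +ᵛ b) ∙ p ≡ a ∙ p + b ∙ p
∙-distribˡ-+ᵛ [] [] [] = refl
∙-distribˡ-+ᵛ (a ∷ as) (b ∷ bs) (x ∷ xs) rewrite ∙-distribˡ-+ᵛ as bs xs = ring a b x (as ∙ xs) (bs ∙ xs)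
  where
  ring : ∀ a b x u v → (a + b) * x + (u + v) ≡ a * x + u + (b * x + v)
  ring = solve-∀

∙-*ᵛʳ : ∀ {m} s (c x : Vec ℤ m) → c ∙ (s *ᵛ x) ≡ s * c ∙ x
∙-*ᵛʳ s [] [] = sym (ℤₚ.*-zeroʳ s)
∙-*ᵛʳ s (a ∷ c) (x ∷ xs) rewrite ∙-*ᵛʳ s c xs = ring s a x (c ∙ xs)
  where
  ring : ∀ s a x u → a * (s * x) + s * u ≡ s * (a * x + u)
  ring = solve-∀

∙-*ᵛˡ : ∀ {m} s (c x : Vec ℤ m) → (s *ᵛ c) ∙ x ≡ s * c ∙ x
∙-*ᵛˡ s [] [] = sym (ℤₚ.*-zeroʳ s)
∙-*ᵛˡ s (a ∷ c) (x ∷ xs) rewrite ∙-*ᵛˡ s c xs = ring s a x (c ∙ xs)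
  where
  ring : ∀ s a x u → s * a * x + s * u ≡ s * (a * x + u)
  ring = solve-∀

∙-zeroʳ : ∀ {m} (c : Vec ℤ m) → c ∙ 0ᵛ m ≡ + 0
∙-zeroʳ [] = refl
∙-zeroʳ (a ∷ c) rewrite ∙-zeroʳ c | ℤₚ.*-zeroʳ a = refl

∙-zeroˡ : ∀ {m} (c : Vec ℤ m) → 0ᵛ m ∙ c ≡ + 0
∙-zeroˡ [] = refl
∙-zeroˡ (a ∷ c) = trans (ℤₚ.+-identityˡ _) (∙-zeroˡ c)

∙-comm : ∀ {m} (c p : Vec ℤ m) → c ∙ p ≡ p ∙ c
∙-comm [] [] = refl
∙-comm (a ∷ c) (x ∷ p) = cong₂ _+_ (ℤₚ.*-comm a x) (∙-comm c p)

+ᵛ-identityˡ : ∀ {m} (x : Vec ℤ m) → 0ᵛ m +ᵛ x ≡ x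
+ᵛ-identityˡ [] = refl
+ᵛ-identityˡ (a ∷ x) = cong₂ _∷_ (ℤₚ.+-identityˡ a) (+ᵛ-identityˡ x)

+ᵛ-swap : ∀ {m} (x y z : Vec ℤ m) → x +ᵛ (y +ᵛ z) ≡ y +ᵛ (x +ᵛ z)
+ᵛ-swap [] [] [] = refl
+ᵛ-swap (a ∷ x) (b ∷ y) (c ∷ z) = cong₂ _∷_ (ring a b c) (+ᵛ-swap x y z)
  where
  ring : ∀ a b c → a + (b + c) ≡ b + (a + c)
  ring = solve-∀

*ᵛ-zeroˡ : ∀ {m} (x : Vec ℤ m) → + 0 *ᵛ x ≡ 0ᵛ m
*ᵛ-zeroˡ [] = refl
*ᵛ-zeroˡ (a ∷ x) = cong (+ 0 ∷_) (*ᵛ-zeroˡ x)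

*ᵛ-zeroʳ : ∀ {m} h → h *ᵛ 0ᵛ m ≡ 0ᵛ m
*ᵛ-zeroʳ {zero} h = refl
*ᵛ-zeroʳ {suc m} h = cong₂ _∷_ (ℤₚ.*-zeroʳ h) (*ᵛ-zeroʳ h)

*ᵛ-assoc : ∀ {m} h a (v : Vec ℤ m) → (h * a) *ᵛ v ≡ h *ᵛ (a *ᵛ v)
*ᵛ-assoc h a [] = refl
*ᵛ-assoc h a (x ∷ v) = cong₂ _∷_ (ℤₚ.*-assoc h a x) (*ᵛ-assoc h a v)

*ᵛ-distribˡ-+ᵛ : ∀ {m} h (x y : Vec ℤ m) → h *ᵛ (x +ᵛ y) ≡ h *ᵛ x +ᵛ h *ᵛ y
*ᵛ-distribˡ-+ᵛ h [] [] = refl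
*ᵛ-distribˡ-+ᵛ h (a ∷ x) (b ∷ y) = cong₂ _∷_ (ℤₚ.*-distribˡ-+ h a b) (*ᵛ-distribˡ-+ᵛ h x y)

*ᵛ-zero-inv : ∀ {m} h (μ : Vec ℤ m) → h ≢ + 0 → h *ᵛ μ ≡ 0ᵛ m → μ ≡ 0ᵛ m
*ᵛ-zero-inv h [] h≢0 eq = refl
*ᵛ-zero-inv h (a ∷ μ) h≢0 eq with ℤₚ.i*j≡0⇒i≡0∨j≡0 h (Vecₚ.∷-injectiveˡ eq)
... | inj₁ h≡0 = ⊥-elim (h≢0 h≡0)
... | inj₂ a≡0 = cong₂ _∷_ a≡0 (*ᵛ-zero-inv h μ h≢0 (Vecₚ.∷-injectiveʳ eq))

unit : ∀ {m} → Fin m → Vec ℤ m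
unit {suc m} zero = + 1 ∷ 0ᵛ m
unit (suc i) = + 0 ∷ unit i

unit-∙ : ∀ {m} (i : Fin m) (p : Vec ℤ m) → unit i ∙ p ≡ lookup p i
unit-∙ zero (x ∷ p) rewrite ∙-zeroˡ p | ℤₚ.*-identityˡ x = ℤₚ.+-identityʳ x
unit-∙ (suc i) (x ∷ p) = trans (ℤₚ.+-identityˡ _) (unit-∙ i p)

∙-unit : ∀ {m} (c : Vec ℤ m) (i : Fin m) → c ∙ unit i ≡ lookup c i
∙-unit c i = trans (∙-comm c (unit i)) (unit-∙ i c)

-- Linear combinations and linear dependence

linComb : ∀ {m} (vs : List (Vec ℤ m)) → Vec ℤ (length vs) → Vec ℤ m
linComb [] _ = 0ᵛ _
linComb (v ∷ vs) (a ∷ as) = a *ᵛ v +ᵛ linComb vs as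

lincomb≡linComb : ∀ {n} (vs : List (Pt n)) μ → lincomb vs μ ≡ linComb vs μ
lincomb≡linComb [] _ = refl
lincomb≡linComb (v ∷ vs) (a ∷ as) = cong (a *ᵛ v +ᵛ_) (lincomb≡linComb vs as)

Dependent : ∀ {m} → List (Vec ℤ m) → Set
Dependent {m} vs = ∃ λ μ → linComb vs μ ≡ 0ᵛ m × μ ≢ 0ᵛ (length vs)

Dependent⇒¬LinIndep : ∀ {n} {vs : List (Pt n)} → Dependent vs → ¬ LinIndep vs
Dependent⇒¬LinIndep {vs = vs} (μ , μ-kills , μ≢0) indep =
  μ≢0 (indep μ (trans (lincomb≡linComb vs μ) μ-kills))

∙-linComb-annihilated : ∀ {m} (c : Vec ℤ m) (vs : List (Vec ℤ m)) μ →
  (∀ v → v ∈ vs → c ∙ v ≡ + 0) → c ∙ linComb vs μ ≡ + 0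
∙-linComb-annihilated c [] _ _ = ∙-zeroʳ c
∙-linComb-annihilated c (v ∷ vs) (a ∷ as) kills
  rewrite ∙-distribʳ-+ᵛ c (a *ᵛ v) (linComb vs as) | ∙-*ᵛʳ a c v | kills v (here refl)
        | ∙-linComb-annihilated c vs as (λ w w∈ → kills w (there w∈)) | ℤₚ.*-zeroʳ a = refl

linComb-*ᵛ : ∀ {m} (vs : List (Vec ℤ m)) h μ → linComb vs (h *ᵛ μ) ≡ h *ᵛ linComb vs μ
linComb-*ᵛ [] h [] = sym (*ᵛ-zeroʳ h)
linComb-*ᵛ (v ∷ vs) h (a ∷ μ) =
  trans (cong₂ _+ᵛ_ (*ᵛ-assoc h a v) (linComb-*ᵛ vs h μ)) (sym (*ᵛ-distribˡ-+ᵛ h _ _))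

module _ {A B : Set} (f : A → B) where

  coeffs⁻ : (xs : List A) → Vec ℤ (length (List.map f xs)) → Vec ℤ (length xs)
  coeffs⁻ [] [] = []
  coeffs⁻ (x ∷ xs) (a ∷ as) = a ∷ coeffs⁻ xs as

  coeffs⁺ : (xs : List A) → Vec ℤ (length xs) → Vec ℤ (length (List.map f xs))
  coeffs⁺ [] [] = []
  coeffs⁺ (x ∷ xs) (a ∷ as) = a ∷ coeffs⁺ xs as

  coeffs⁻-zero-inv : ∀ xs ν → coeffs⁻ xs ν ≡ 0ᵛ _ → ν ≡ 0ᵛ _
  coeffs⁻-zero-inv [] [] _ = refl
  coeffs⁻-zero-inv (x ∷ xs) (a ∷ as) eq =
    cong₂ _∷_ (Vecₚ.∷-injectiveˡ eq) (coeffs⁻-zero-inv xs as (Vecₚ.∷-injectiveʳ eq))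

  coeffs⁺-zero-inv : ∀ xs μ → coeffs⁺ xs μ ≡ 0ᵛ _ → μ ≡ 0ᵛ _
  coeffs⁺-zero-inv [] [] _ = refl
  coeffs⁺-zero-inv (x ∷ xs) (a ∷ as) eq =
    cong₂ _∷_ (Vecₚ.∷-injectiveˡ eq) (coeffs⁺-zero-inv xs as (Vecₚ.∷-injectiveʳ eq))

  coeffs⁻∘coeffs⁺ : ∀ xs μ → coeffs⁻ xs (coeffs⁺ xs μ) ≡ μ
  coeffs⁻∘coeffs⁺ [] [] = refl
  coeffs⁻∘coeffs⁺ (x ∷ xs) (a ∷ as) = cong (a ∷_) (coeffs⁻∘coeffs⁺ xs as)

record Linear {m k} (F : Vec ℤ m → Vec ℤ k) : Set where
  field
    map-+ᵛ : ∀ x y → F (x +ᵛ y) ≡ F x +ᵛ F y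
    map-*ᵛ : ∀ a x → F (a *ᵛ x) ≡ a *ᵛ F x

module _ {m k} {F : Vec ℤ m → Vec ℤ k} (F-linear : Linear F) where
  open Linear F-linear

  map-0ᵛ : F (0ᵛ m) ≡ 0ᵛ k
  map-0ᵛ = begin
    F (0ᵛ m)            ≡⟨ cong F (sym (*ᵛ-zeroˡ (0ᵛ m))) ⟩
    F (+ 0 *ᵛ 0ᵛ m)     ≡⟨ map-*ᵛ (+ 0) (0ᵛ m) ⟩
    + 0 *ᵛ F (0ᵛ m)     ≡⟨ *ᵛ-zeroˡ (F (0ᵛ m)) ⟩
    0ᵛ k                ∎
    where open ≡-Reasoning

  linComb-map : ∀ vs ν → linComb (List.map F vs) ν ≡ F (linComb vs (coeffs⁻ F vs ν))
  linComb-map [] [] = sym map-0ᵛ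
  linComb-map (v ∷ vs) (a ∷ ν) = begin
    a *ᵛ F v +ᵛ linComb (List.map F vs) ν   ≡⟨ cong (a *ᵛ F v +ᵛ_) (linComb-map vs ν) ⟩
    a *ᵛ F v +ᵛ F (linComb vs μ)            ≡⟨ cong (_+ᵛ F (linComb vs μ)) (sym (map-*ᵛ a v)) ⟩
    F (a *ᵛ v) +ᵛ F (linComb vs μ)          ≡⟨ sym (map-+ᵛ (a *ᵛ v) (linComb vs μ)) ⟩
    F (a *ᵛ v +ᵛ linComb vs μ)              ∎
    where
    open ≡-Reasoning
    μ = coeffs⁻ F vs ν

  linComb-map⁺ : ∀ vs μ → linComb (List.map F vs) (coeffs⁺ F vs μ) ≡ F (linComb vs μ)
  linComb-map⁺ vs μ =
    trans (linComb-map vs (coeffs⁺ F vs μ)) (cong (λ μ → F (linComb vs μ)) (coeffs⁻∘coeffs⁺ F vs μ))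

tail-linear : ∀ {m} → Linear (Vec.tail {n = m})
tail-linear = record
  { map-+ᵛ = λ { (_ ∷ _) (_ ∷ _) → refl }
  ; map-*ᵛ = λ { _ (_ ∷ _) → refl }
  }

-- One step of fraction-free Gaussian elimination: clear the first entry of u against the
-- pivot row h ∷ t.
eliminate : ∀ {m} → ℤ → Vec ℤ m → Vec ℤ (suc m) → Vec ℤ m
eliminate h t u = h *ᵛ Vec.tail u -ᵛ Vec.head u *ᵛ t

eliminate-linear : ∀ {m} h (t : Vec ℤ m) → Linear (eliminate h t)
eliminate-linear h t = record
  { map-+ᵛ = λ { (a ∷ x) (b ∷ y) → additive a b x y t }
  ; map-*ᵛ = λ { s (a ∷ x) → homogeneous s a x t }
  }
  where
  additive : ∀ {m} a b (x y t : Vec ℤ m) →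
    h *ᵛ (x +ᵛ y) -ᵛ (a + b) *ᵛ t ≡ (h *ᵛ x -ᵛ a *ᵛ t) +ᵛ (h *ᵛ y -ᵛ b *ᵛ t)
  additive a b [] [] [] = refl
  additive a b (x ∷ xs) (y ∷ ys) (t ∷ ts) = cong₂ _∷_ (ring h a b x y t) (additive a b xs ys ts)
    where
    ring : ∀ h a b x y t → h * (x + y) - (a + b) * t ≡ h * x - a * t + (h * y - b * t)
    ring = solve-∀
  homogeneous : ∀ {m} s a (x t : Vec ℤ m) → h *ᵛ (s *ᵛ x) -ᵛ (s * a) *ᵛ t ≡ s *ᵛ (h *ᵛ x -ᵛ a *ᵛ t)
  homogeneous s a [] [] = refl
  homogeneous s a (x ∷ xs) (t ∷ ts) = cong₂ _∷_ (ring h s a x t) (homogeneous s a xs ts)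
    where
    ring : ∀ h s a x t → h * (s * x) - s * a * t ≡ s * (h * x - a * t)
    ring = solve-∀

pivot-relation : ∀ {m} h (t : Vec ℤ m) X → eliminate h t X ≡ 0ᵛ m → (- Vec.head X) *ᵛ (h ∷ t) +ᵛ h *ᵛ X ≡ 0ᵛ (suc m)
pivot-relation h t (x ∷ xs) killed = cong₂ _∷_ (ring x h) (trans (reorder xs t) killed)
  where
  ring : ∀ x h → - x * h + h * x ≡ + 0
  ring = solve-∀
  reorder : ∀ {m} (xs t : Vec ℤ m) → (- x) *ᵛ t +ᵛ h *ᵛ xs ≡ h *ᵛ xs -ᵛ x *ᵛ t
  reorder [] [] = refl
  reorder (y ∷ ys) (t ∷ ts) = cong₂ _∷_ (ring2 x y h t) (reorder ys ts)
    where
    ring2 : ∀ x y h t → - x * t + h * y ≡ h * y - x * t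
    ring2 = solve-∀

joinCoeffs : ∀ {m} (As : List (Vec ℤ m)) {y Bs} → ℤ → Vec ℤ (length (As ++ Bs)) → Vec ℤ (length (As ++ y ∷ Bs))
joinCoeffs [] a r = a ∷ r
joinCoeffs (x ∷ As) a (b ∷ r) = b ∷ joinCoeffs As a r

linComb-join : ∀ {m} (As : List (Vec ℤ m)) {y Bs} a r →
  linComb (As ++ y ∷ Bs) (joinCoeffs As a r) ≡ a *ᵛ y +ᵛ linComb (As ++ Bs) r
linComb-join [] a r = refl
linComb-join (x ∷ As) a (b ∷ r) = trans (cong (b *ᵛ x +ᵛ_) (linComb-join As a r)) (+ᵛ-swap (b *ᵛ x) _ _)

joinCoeffs-zero-inv : ∀ {m} (As : List (Vec ℤ m)) {y Bs} a r → joinCoeffs As {y} {Bs} a r ≡ 0ᵛ _ → r ≡ 0ᵛ _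
joinCoeffs-zero-inv [] a r eq = Vecₚ.∷-injectiveʳ eq
joinCoeffs-zero-inv (x ∷ As) a (b ∷ r) eq =
  cong₂ _∷_ (Vecₚ.∷-injectiveˡ eq) (joinCoeffs-zero-inv As a r (Vecₚ.∷-injectiveʳ eq))

joinCoeffs-surjective : ∀ {m} (As : List (Vec ℤ m)) {y Bs} (μ : Vec ℤ (length (As ++ y ∷ Bs))) →
  ∃ λ a → ∃ λ r → μ ≡ joinCoeffs As a r
joinCoeffs-surjective [] (a ∷ r) = a , r , refl
joinCoeffs-surjective (x ∷ As) (b ∷ μ) with joinCoeffs-surjective As μ
... | a , r , refl = a , b ∷ r , refl

joinCoeffs-zero : ∀ {m} (As : List (Vec ℤ m)) {y Bs} → joinCoeffs As {y} {Bs} (+ 0) (0ᵛ _) ≡ 0ᵛ _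
joinCoeffs-zero [] = refl
joinCoeffs-zero (x ∷ As) = cong (+ 0 ∷_) (joinCoeffs-zero As)

pivot-or-zero-heads : ∀ {m} (vs : List (Vec ℤ (suc m))) →
  (∃ λ As → ∃ λ v → ∃ λ Bs → vs ≡ As ++ v ∷ Bs × lookup v zero ≢ + 0) ⊎ All (λ v → lookup v zero ≡ + 0) vs
pivot-or-zero-heads vs with All.all? (λ v → lookup v zero ℤ.≟ + 0) vs
... | yes zero-heads = inj₂ zero-heads
... | no ¬zero-heads with find (Allₚ.¬All⇒Any¬ (λ v → lookup v zero ℤ.≟ + 0) vs ¬zero-heads)
...   | v , v∈ , head≢0 with ∈-∃++ v∈
...     | As , Bs , vs≡ = inj₁ (As , v , Bs , vs≡ , head≢0)

zero-heads⇒Dependent : ∀ {m} (vs : List (Vec ℤ (suc m))) → All (λ v → lookup v zero ≡ + 0) vs →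
  Dependent (List.map Vec.tail vs) → Dependent vs
zero-heads⇒Dependent {m} vs zero-heads (ν , ν-kills , ν≢0) =
  μ , kills , λ μ≡0 → ν≢0 (coeffs⁻-zero-inv Vec.tail vs ν μ≡0)
  where
  μ = coeffs⁻ Vec.tail vs ν
  head≡0 : lookup (linComb vs μ) zero ≡ + 0
  head≡0 = trans (sym (unit-∙ zero (linComb vs μ)))
    (∙-linComb-annihilated (unit zero) vs μ (λ v v∈ → trans (unit-∙ zero v) (All.lookup zero-heads v∈)))
  tail≡0 : Vec.tail (linComb vs μ) ≡ 0ᵛ m
  tail≡0 = trans (sym (linComb-map tail-linear vs ν)) ν-kills
  kills : linComb vs μ ≡ 0ᵛ (suc m)
  kills with linComb vs μ | head≡0 | tail≡0
  ... | _ ∷ _ | refl | refl = refl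

pivot⇒Dependent : ∀ {m} (As : List (Vec ℤ (suc m))) h t Bs → h ≢ + 0 →
  Dependent (List.map (eliminate h t) (As ++ Bs)) → Dependent (As ++ (h ∷ t) ∷ Bs)
pivot⇒Dependent {m} As h t Bs h≢0 (ν , ν-kills , ν≢0) =
  joinCoeffs As (- Vec.head X) (h *ᵛ μ) , kills ,
  λ joined≡0 → ν≢0 (coeffs⁻-zero-inv (eliminate h t) (As ++ Bs) ν
                      (*ᵛ-zero-inv h μ h≢0 (joinCoeffs-zero-inv As _ _ joined≡0)))
  where
  μ = coeffs⁻ (eliminate h t) (As ++ Bs) ν
  X = linComb (As ++ Bs) μ
  kills : linComb (As ++ (h ∷ t) ∷ Bs) (joinCoeffs As (- Vec.head X) (h *ᵛ μ)) ≡ 0ᵛ (suc m)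
  kills = begin
    linComb (As ++ (h ∷ t) ∷ Bs) (joinCoeffs As (- Vec.head X) (h *ᵛ μ))
      ≡⟨ linComb-join As (- Vec.head X) (h *ᵛ μ) ⟩
    (- Vec.head X) *ᵛ (h ∷ t) +ᵛ linComb (As ++ Bs) (h *ᵛ μ)
      ≡⟨ cong ((- Vec.head X) *ᵛ (h ∷ t) +ᵛ_) (linComb-*ᵛ (As ++ Bs) h μ) ⟩
    (- Vec.head X) *ᵛ (h ∷ t) +ᵛ h *ᵛ X
      ≡⟨ pivot-relation h t X (trans (sym (linComb-map (eliminate-linear h t) (As ++ Bs) ν)) ν-kills) ⟩
    0ᵛ (suc m) ∎
    where open ≡-Reasoning

m<length⇒Dependent : ∀ m (vs : List (Vec ℤ m)) → m ℕ.< length vs → Dependent vs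
m<length⇒Dependent zero (v ∷ vs) _ = (+ 1 ∷ 0ᵛ _) , empty (linComb (v ∷ vs) (+ 1 ∷ 0ᵛ _)) , λ ()
  where
  empty : (x : Vec ℤ 0) → x ≡ []
  empty [] = refl
m<length⇒Dependent (suc m) vs long with pivot-or-zero-heads vs
... | inj₂ zero-heads = zero-heads⇒Dependent vs zero-heads (m<length⇒Dependent m (List.map Vec.tail vs)
  (subst (m ℕ.<_) (sym (Listₚ.length-map Vec.tail vs)) (ℕₚ.<-trans (ℕₚ.n<1+n m) long)))
... | inj₁ (As , h ∷ t , Bs , refl , h≢0) = pivot⇒Dependent As h t Bs h≢0
  (m<length⇒Dependent m (List.map (eliminate h t) (As ++ Bs))
    (subst (m ℕ.<_) (sym (Listₚ.length-map (eliminate h t) (As ++ Bs)))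
      (ℕₚ.≤-pred (subst (suc m ℕ.<_) (length-insert As) long))))

-- A vector with coordinate sum 0 is determined by its tail, so dependencies among the
-- tails lift.
sum-zero⇒Dependent : ∀ {n} (Ls : List (Pt n)) → (∀ v → v ∈ Ls → 1ᵛ (suc n) ∙ v ≡ + 0) →
  n ℕ.< length Ls → Dependent Ls
sum-zero⇒Dependent {n} Ls sum-zero long
  with m<length⇒Dependent n (List.map Vec.tail Ls) (subst (n ℕ.<_) (sym (Listₚ.length-map Vec.tail Ls)) long)
... | ν , ν-kills , ν≢0 = μ , lift (linComb Ls μ) tail≡0 (∙-linComb-annihilated (1ᵛ (suc n)) Ls μ sum-zero) ,
                          λ μ≡0 → ν≢0 (coeffs⁻-zero-inv Vec.tail Ls ν μ≡0)
  where
  μ = coeffs⁻ Vec.tail Ls ν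
  tail≡0 : Vec.tail (linComb Ls μ) ≡ 0ᵛ n
  tail≡0 = trans (sym (linComb-map tail-linear Ls ν)) ν-kills
  lift : ∀ X → Vec.tail X ≡ 0ᵛ n → 1ᵛ (suc n) ∙ X ≡ + 0 → X ≡ 0ᵛ (suc n)
  lift (x ∷ xs) refl sum≡0 = cong (_∷ 0ᵛ n) (begin
    x                        ≡⟨ sym (ℤₚ.*-identityˡ x) ⟩
    + 1 * x                  ≡⟨ sym (ℤₚ.+-identityʳ _) ⟩
    + 1 * x + + 0            ≡⟨ cong (λ u → + 1 * x + u) (sym (∙-zeroʳ (1ᵛ n))) ⟩
    1ᵛ (suc n) ∙ (x ∷ 0ᵛ n)  ≡⟨ sum≡0 ⟩
    + 0                      ∎)
    where open ≡-Reasoning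

-- A functional c vanishing on the old vectors but not on y isolates the coefficient of y.
LinIndep-insert : ∀ {n} (As Bs : List (Pt n)) y (c : Pt n) → LinIndep (As ++ Bs) →
  (∀ x → x ∈ As ++ Bs → c ∙ x ≡ + 0) → c ∙ y ≢ + 0 → LinIndep (As ++ y ∷ Bs)
LinIndep-insert As Bs y c indep kills c∙y≢0 μ μ-kills with joinCoeffs-surjective As μ
... | a , r , refl = trans (cong₂ (joinCoeffs As) a≡0 r≡0) (joinCoeffs-zero As)
  where
  combination≡0 : a *ᵛ y +ᵛ linComb (As ++ Bs) r ≡ 0ᵛ _
  combination≡0 = trans (sym (linComb-join As a r))
    (trans (sym (lincomb≡linComb (As ++ y ∷ Bs) (joinCoeffs As a r))) μ-kills)
  a*c∙y≡0 : a * c ∙ y ≡ + 0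
  a*c∙y≡0 = begin
    a * c ∙ y                                      ≡⟨ sym (ℤₚ.+-identityʳ _) ⟩
    a * c ∙ y + + 0                                ≡⟨ cong (λ u → a * c ∙ y + u) (sym (∙-linComb-annihilated c (As ++ Bs) r kills)) ⟩
    a * c ∙ y + c ∙ linComb (As ++ Bs) r           ≡⟨ cong (_+ c ∙ linComb (As ++ Bs) r) (sym (∙-*ᵛʳ a c y)) ⟩
    c ∙ (a *ᵛ y) + c ∙ linComb (As ++ Bs) r        ≡⟨ sym (∙-distribʳ-+ᵛ c (a *ᵛ y) _) ⟩
    c ∙ (a *ᵛ y +ᵛ linComb (As ++ Bs) r)           ≡⟨ cong (c ∙_) combination≡0 ⟩
    c ∙ 0ᵛ _                                       ≡⟨ ∙-zeroʳ c ⟩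
    + 0                                            ∎
    where open ≡-Reasoning
  a≡0 : a ≡ + 0
  a≡0 with ℤₚ.i*j≡0⇒i≡0∨j≡0 a a*c∙y≡0
  ... | inj₁ a≡0 = a≡0
  ... | inj₂ c∙y≡0 = ⊥-elim (c∙y≢0 c∙y≡0)
  r≡0 : r ≡ 0ᵛ _
  r≡0 = indep r (trans (lincomb≡linComb (As ++ Bs) r) (begin
    linComb (As ++ Bs) r                 ≡⟨ sym (+ᵛ-identityˡ _) ⟩
    0ᵛ _ +ᵛ linComb (As ++ Bs) r         ≡⟨ cong (_+ᵛ linComb (As ++ Bs) r) (sym (*ᵛ-zeroˡ y)) ⟩
    + 0 *ᵛ y +ᵛ linComb (As ++ Bs) r     ≡⟨ cong (λ b → b *ᵛ y +ᵛ linComb (As ++ Bs) r) (sym a≡0) ⟩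
    a *ᵛ y +ᵛ linComb (As ++ Bs) r       ≡⟨ combination≡0 ⟩
    0ᵛ _                                 ∎))
    where open ≡-Reasoning

padCoeffs : ∀ {m} {P T : List (Vec ℤ m)} → P ⊆ T → Vec ℤ (length P) → Vec ℤ (length T)
padCoeffs [] [] = []
padCoeffs (y ∷ʳ P⊆T) μ = + 0 ∷ padCoeffs P⊆T μ
padCoeffs (refl ∷ P⊆T) (a ∷ μ) = a ∷ padCoeffs P⊆T μ

linComb-pad : ∀ {m} {P T : List (Vec ℤ m)} (P⊆T : P ⊆ T) μ → linComb T (padCoeffs P⊆T μ) ≡ linComb P μ
linComb-pad [] [] = refl
linComb-pad {T = y ∷ T} (y ∷ʳ P⊆T) μ =
  trans (cong (_+ᵛ linComb T (padCoeffs P⊆T μ)) (*ᵛ-zeroˡ y)) (trans (+ᵛ-identityˡ _) (linComb-pad P⊆T μ))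
linComb-pad (refl ∷ P⊆T) (a ∷ μ) = cong (a *ᵛ _ +ᵛ_) (linComb-pad P⊆T μ)

padCoeffs-zero-inv : ∀ {m} {P T : List (Vec ℤ m)} (P⊆T : P ⊆ T) μ → padCoeffs P⊆T μ ≡ 0ᵛ _ → μ ≡ 0ᵛ _
padCoeffs-zero-inv [] [] _ = refl
padCoeffs-zero-inv (y ∷ʳ P⊆T) μ eq = padCoeffs-zero-inv P⊆T μ (Vecₚ.∷-injectiveʳ eq)
padCoeffs-zero-inv (refl ∷ P⊆T) (a ∷ μ) eq =
  cong₂ _∷_ (Vecₚ.∷-injectiveˡ eq) (padCoeffs-zero-inv P⊆T μ (Vecₚ.∷-injectiveʳ eq))

LinIndep-⊆ : ∀ {n} {P T : List (Pt n)} → P ⊆ T → LinIndep T → LinIndep P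
LinIndep-⊆ {P = P} {T} P⊆T indep μ μ-kills = padCoeffs-zero-inv P⊆T μ (indep (padCoeffs P⊆T μ) (begin
  lincomb T (padCoeffs P⊆T μ)   ≡⟨ lincomb≡linComb T _ ⟩
  linComb T (padCoeffs P⊆T μ)   ≡⟨ linComb-pad P⊆T μ ⟩
  linComb P μ                   ≡⟨ sym (lincomb≡linComb P μ) ⟩
  lincomb P μ                   ≡⟨ μ-kills ⟩
  zeroPt                        ∎))
  where open ≡-Reasoning

-- The generators e_i − e_j and the graph

vectors : ∀ {n} → GenSet n → List (Pt n)
vectors V = List.map vec (gens V)

δ-refl : ∀ {m} (i : Fin m) → δ i i ≡ + 1
δ-refl i with i Fin.≟ i
... | yes _ = refl
... | no i≢i = ⊥-elim (i≢i refl)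

δ-≢ : ∀ {m} {i k : Fin m} → i ≢ k → δ i k ≡ + 0
δ-≢ {i = i} {k} i≢k with i Fin.≟ k
... | yes i≡k = ⊥-elim (i≢k i≡k)
... | no _ = refl

δ-suc : ∀ {m} (i k : Fin m) → δ (suc i) (suc k) ≡ δ i k
δ-suc i k with i Fin.≟ k
... | yes refl = refl
... | no _ = refl

tabulate-δ : ∀ {m} (i : Fin m) → tabulate (δ i) ≡ unit i
tabulate-δ {suc m} zero = cong (+ 1 ∷_) (tabulate-δ-zero m)
  where
  tabulate-δ-zero : ∀ m → tabulate {n = m} (λ k → δ {suc m} zero (suc k)) ≡ 0ᵛ m
  tabulate-δ-zero zero = refl
  tabulate-δ-zero (suc m) = cong (+ 0 ∷_) (tabulate-δ-zero m)
tabulate-δ (suc i) = cong (+ 0 ∷_) (trans (Vecₚ.tabulate-cong (δ-suc i)) (tabulate-δ i))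

tabulate-subᵛ : ∀ {m} (f g : Fin m → ℤ) → tabulate (λ k → f k - g k) ≡ tabulate f -ᵛ tabulate g
tabulate-subᵛ {zero} f g = refl
tabulate-subᵛ {suc m} f g = cong (f zero - g zero ∷_) (tabulate-subᵛ (λ k → f (suc k)) (λ k → g (suc k)))

vec≡unit-unit : ∀ {n} (i j : Fin (suc n)) → vec (i , j) ≡ unit i -ᵛ unit j
vec≡unit-unit i j = trans (tabulate-subᵛ (δ i) (δ j)) (cong₂ _-ᵛ_ (tabulate-δ i) (tabulate-δ j))

lookup-vec : ∀ {n} (i j w : Fin (suc n)) → lookup (vec (i , j)) w ≡ δ i w - δ j w
lookup-vec i j = Vecₚ.lookup∘tabulate (λ k → δ i k - δ j k)

∙-vec : ∀ {n} (c : Pt n) i j → c ∙ vec (i , j) ≡ lookup c i - lookup c j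
∙-vec c i j rewrite vec≡unit-unit i j | ∙-distribʳ-subᵛ c (unit i) (unit j) | ∙-unit c i | ∙-unit c j = refl

lookup-vec-source : ∀ {n} {i j : Fin (suc n)} → i ≢ j → lookup (vec (i , j)) i ≡ + 1
lookup-vec-source {i = i} {j} i≢j rewrite lookup-vec i j i | δ-refl i | δ-≢ (i≢j ∘ sym) = refl

lookup-vec-target : ∀ {n} {i j : Fin (suc n)} → i ≢ j → lookup (vec (i , j)) j ≡ -[1+ 0 ]
lookup-vec-target {i = i} {j} i≢j rewrite lookup-vec i j j | δ-≢ i≢j | δ-refl j = refl

vec-support : ∀ {n} (i j v : Fin (suc n)) → v ≢ i → v ≢ j → lookup (vec (i , j)) v ≡ + 0
vec-support i j v v≢i v≢j rewrite lookup-vec i j v | δ-≢ (v≢i ∘ sym) | δ-≢ (v≢j ∘ sym) = refl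

1ᵛ-⊥-vec : ∀ {n} (i j : Fin (suc n)) → 1ᵛ (suc n) ∙ vec (i , j) ≡ + 0
1ᵛ-⊥-vec i j rewrite ∙-vec (1ᵛ _) i j | Vecₚ.lookup-replicate i (+ 1) | Vecₚ.lookup-replicate j (+ 1) = refl

1ᵛ-⊥-vectors : ∀ {n} (V : GenSet n) {v} → v ∈ vectors V → 1ᵛ (suc n) ∙ v ≡ + 0
1ᵛ-⊥-vectors V v∈ with ∈-map⁻ vec v∈
... | (i , j) , _ , refl = 1ᵛ-⊥-vec i j

module _ {n} {V : GenSet n} where

  Reach-trans : ∀ {a b c} → Reach V a b → Reach V b c → Reach V a c
  Reach-trans here r = r
  Reach-trans (stepF e r) r′ = stepF e (Reach-trans r r′)
  Reach-trans (stepB e r) r′ = stepB e (Reach-trans r r′)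

  Reach-sym : ∀ {a b} → Reach V a b → Reach V b a
  Reach-sym here = here
  Reach-sym (stepF e r) = Reach-trans (Reach-sym r) (stepB e here)
  Reach-sym (stepB e r) = Reach-trans (Reach-sym r) (stepF e here)

-- φ carries the subset sums of V onto those of W, and every linear functional on either
-- side agrees on subset sums with one on the other side; this is all that vertices and
-- faces of the two zonotopes depend on.
record SumsIso {n m} (V : GenSet n) (W : GenSet m) : Set where
  field
    φ : Pt n → Pt m
    sums-image : SubsetSums W ≡ List.map φ (SubsetSums V)
    push : ∀ c → ∃ λ c′ → ∀ p → p ∈ SubsetSums V → c′ ∙ φ p ≡ c ∙ p
    pull : ∀ c′ → ∃ λ c → ∀ p → p ∈ SubsetSums V → c′ ∙ φ p ≡ c ∙ p

SumsIso-refl : ∀ {n} (V : GenSet n) → SumsIso V V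
SumsIso-refl V = record
  { φ = λ x → x
  ; sums-image = sym (Listₚ.map-id (SubsetSums V))
  ; push = λ c → c , λ _ _ → refl
  ; pull = λ c → c , λ _ _ → refl
  }

SumsIso-trans : ∀ {n m k} {U : GenSet n} {V : GenSet m} {W : GenSet k} → SumsIso U V → SumsIso V W → SumsIso U W
SumsIso-trans {U = U} {V} UV VW = record
  { φ = λ x → VW.φ (UV.φ x)
  ; sums-image = trans VW.sums-image (trans (cong (List.map VW.φ) UV.sums-image) (sym (Listₚ.map-∘ (SubsetSums U))))
  ; push = λ c → let c′ , agree = UV.push c ; c″ , agree′ = VW.push c′ in
      c″ , λ p p∈ → trans (agree′ (UV.φ p) (in-V p∈)) (agree p p∈)
  ; pull = λ c″ → let c′ , agree′ = VW.pull c″ ; c , agree = UV.pull c′ in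
      c , λ p p∈ → trans (agree′ (UV.φ p) (in-V p∈)) (agree p p∈)
  }
  where
  module UV = SumsIso UV
  module VW = SumsIso VW
  in-V : ∀ {p} → p ∈ SubsetSums U → UV.φ p ∈ SubsetSums V
  in-V p∈ = subst (_ ∈_) (sym UV.sums-image) (∈-map⁺ UV.φ p∈)

module _ {n m} {V : GenSet n} {W : GenSet m} (iso : SumsIso V W) where
  open SumsIso iso

  private
    Agree : Pt n → Pt m → Set
    Agree c c′ = ∀ p → p ∈ SubsetSums V → c′ ∙ φ p ≡ c ∙ p

  φ-sum : ∀ {p} → p ∈ SubsetSums V → φ p ∈ SubsetSums W
  φ-sum p∈ = subst (_ ∈_) (sym sums-image) (∈-map⁺ φ p∈)

  φ-image : ∀ {y} → y ∈ SubsetSums W → ∃ λ p → p ∈ SubsetSums V × y ≡ φ p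
  φ-image y∈ = ∈-map⁻ φ (subst (_ ∈_) sums-image y∈)

  φ-injective : ∀ {p q} → p ∈ SubsetSums V → q ∈ SubsetSums V → φ p ≡ φ q → p ≡ q
  φ-injective {p} {q} p∈ q∈ φp≡φq = vec-ext λ i → let c′ , agree = push (unit i) in
    trans (sym (unit-∙ i p)) (trans (sym (agree p p∈)) (trans (cong (c′ ∙_) φp≡φq) (trans (agree q q∈) (unit-∙ i q))))

  find-preimage : List (Pt n) → Pt m → Pt n
  find-preimage [] y = zeroPt
  find-preimage (p ∷ ps) y with Vecₚ.≡-dec ℤ._≟_ (φ p) y
  ... | yes _ = p
  ... | no _ = find-preimage ps y

  find-preimage-correct : ∀ {p} ps → (∀ {q} → q ∈ ps → q ∈ SubsetSums V) → p ∈ SubsetSums V → p ∈ ps →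
    find-preimage ps (φ p) ≡ p
  find-preimage-correct {p} (q ∷ ps) sums p∈ p∈ps with Vecₚ.≡-dec ℤ._≟_ (φ q) (φ p) | p∈ps
  ... | yes φq≡φp | _ = φ-injective (sums (here refl)) p∈ φq≡φp
  ... | no φq≢φp | here refl = ⊥-elim (φq≢φp refl)
  ... | no _ | there p∈ps′ = find-preimage-correct ps (λ q∈ → sums (there q∈)) p∈ p∈ps′

  ψ : Pt m → Pt n
  ψ = find-preimage (SubsetSums V)

  ψ∘φ : ∀ {p} → p ∈ SubsetSums V → ψ (φ p) ≡ p
  ψ∘φ p∈ = find-preimage-correct (SubsetSums V) (λ q∈ → q∈) p∈ p∈

  module _ {c c′} (agree : Agree c c′) {x} (x∈ : x ∈ SubsetSums V) where

    maximum-push : (∀ p → p ∈ SubsetSums V → c ∙ p ℤ.≤ c ∙ x) →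
      ∀ q → q ∈ SubsetSums W → c′ ∙ q ℤ.≤ c′ ∙ φ x
    maximum-push max q q∈ with φ-image q∈
    ... | p , p∈ , refl = subst₂ ℤ._≤_ (sym (agree p p∈)) (sym (agree x x∈)) (max p p∈)

    maximum-pull : (∀ q → q ∈ SubsetSums W → c′ ∙ q ℤ.≤ c′ ∙ φ x) →
      ∀ p → p ∈ SubsetSums V → c ∙ p ℤ.≤ c ∙ x
    maximum-pull max p p∈ = subst₂ ℤ._≤_ (agree p p∈) (agree x x∈) (max (φ p) (φ-sum p∈))

    strict-maximum-push : (∀ p → p ∈ SubsetSums V → p ≢ x → c ∙ p ℤ.< c ∙ x) →
      ∀ q → q ∈ SubsetSums W → q ≢ φ x → c′ ∙ q ℤ.< c′ ∙ φ x
    strict-maximum-push max q q∈ q≢φx with φ-image q∈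
    ... | p , p∈ , refl = subst₂ ℤ._<_ (sym (agree p p∈)) (sym (agree x x∈)) (max p p∈ (λ p≡x → q≢φx (cong φ p≡x)))

    strict-maximum-pull : (∀ q → q ∈ SubsetSums W → q ≢ φ x → c′ ∙ q ℤ.< c′ ∙ φ x) →
      ∀ p → p ∈ SubsetSums V → p ≢ x → c ∙ p ℤ.< c ∙ x
    strict-maximum-pull max p p∈ p≢x =
      subst₂ ℤ._<_ (agree p p∈) (agree x x∈) (max (φ p) (φ-sum p∈) (λ φp≡φx → p≢x (φ-injective p∈ x∈ φp≡φx)))

  IsVertex-push : ∀ {x} → IsVertex V x → IsVertex W (φ x)
  IsVertex-push (x∈ , c , max) = let c′ , agree = push c in φ-sum x∈ , c′ , strict-maximum-push {c} {c′} agree x∈ max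

  IsVertex-pull : ∀ {x} → x ∈ SubsetSums V → IsVertex W (φ x) → IsVertex V x
  IsVertex-pull x∈ (_ , c′ , max) = let c , agree = pull c′ in x∈ , c , strict-maximum-pull {c} {c′} agree x∈ max

  InFace-push : ∀ {c c′ x} → Agree c c′ → InFace V c x → InFace W c′ (φ x)
  InFace-push {c} {c′} agree (vertex , max) = IsVertex-push vertex , maximum-push {c} {c′} agree (proj₁ vertex) max

  InFace-pull : ∀ {c c′ x} → Agree c c′ → x ∈ SubsetSums V → InFace W c′ (φ x) → InFace V c x
  InFace-pull {c} {c′} agree x∈ (vertex , max) = IsVertex-pull x∈ vertex , maximum-pull {c} {c′} agree x∈ max

  SumsIso⇒CombEquiv : CombEquiv V W
  SumsIso⇒CombEquiv = φ , ψ , vertices-push , vertices-pull , faces-push , faces-pull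
    where
    vertices-push : ∀ x → IsVertex V x → IsVertex W (φ x) × ψ (φ x) ≡ x
    vertices-push x vertex = IsVertex-push vertex , ψ∘φ (proj₁ vertex)
    vertices-pull : ∀ y → IsVertex W y → IsVertex V (ψ y) × φ (ψ y) ≡ y
    vertices-pull y vertex with φ-image (proj₁ vertex)
    ... | p , p∈ , refl rewrite ψ∘φ p∈ = IsVertex-pull p∈ vertex , refl
    faces-push : ∀ c → ∃ λ c′ → ∀ x → IsVertex V x →
      (InFace V c x → InFace W c′ (φ x)) × (InFace W c′ (φ x) → InFace V c x)
    faces-push c = let c′ , agree = push c in
      c′ , λ x vertex → InFace-push {c} {c′} agree , InFace-pull {c} {c′} agree (proj₁ vertex)
    faces-pull : ∀ c′ → ∃ λ c → ∀ y → IsVertex W y →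
      (InFace W c′ y → InFace V c (ψ y)) × (InFace V c (ψ y) → InFace W c′ y)
    faces-pull c′ = let c , agree = pull c′ in c , λ y vertex → faces-at {c} agree (φ-image (proj₁ vertex))
      where
      faces-at : ∀ {c y} → Agree c c′ → (∃ λ p → p ∈ SubsetSums V × y ≡ φ p) →
        (InFace W c′ y → InFace V c (ψ y)) × (InFace V c (ψ y) → InFace W c′ y)
      faces-at {c} agree (p , p∈ , refl) rewrite ψ∘φ p∈ = InFace-pull {c} {c′} agree p∈ , InFace-push {c} {c′} agree

-- Merging two coordinates

merge : ∀ {n} → Fin (suc n) → Vec ℤ (suc (suc n)) → Vec ℤ (suc n)
merge zero (a ∷ b ∷ xs) = a + b ∷ xs
merge {suc n} (suc k) (a ∷ xs) = a ∷ merge k xs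

merge-linear : ∀ {n} (k : Fin (suc n)) → Linear (merge k)
merge-linear k = record { map-+ᵛ = additive k ; map-*ᵛ = homogeneous k }
  where
  additive : ∀ {n} (k : Fin (suc n)) x y → merge k (x +ᵛ y) ≡ merge k x +ᵛ merge k y
  additive zero (a ∷ b ∷ xs) (c ∷ d ∷ ys) = cong (_∷ _) (ring a b c d)
    where
    ring : ∀ a b c d → a + c + (b + d) ≡ a + b + (c + d)
    ring = solve-∀
  additive {suc n} (suc k) (a ∷ xs) (c ∷ ys) = cong (_ ∷_) (additive k xs ys)
  homogeneous : ∀ {n} (k : Fin (suc n)) s x → merge k (s *ᵛ x) ≡ s *ᵛ merge k x
  homogeneous zero s (a ∷ b ∷ xs) = cong (_∷ _) (sym (ℤₚ.*-distribˡ-+ s a b))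
  homogeneous {suc n} (suc k) s (a ∷ xs) = cong (_ ∷_) (homogeneous k s xs)

merge-subᵛ : ∀ {n} (k : Fin (suc n)) x y → merge k (x -ᵛ y) ≡ merge k x -ᵛ merge k y
merge-subᵛ zero (a ∷ b ∷ xs) (c ∷ d ∷ ys) = cong (_∷ _) (ring a b c d)
  where
  ring : ∀ a b c d → a - c + (b - d) ≡ a + b - (c + d)
  ring = solve-∀
merge-subᵛ {suc n} (suc k) (a ∷ xs) (c ∷ ys) = cong (_ ∷_) (merge-subᵛ k xs ys)

merge-unit : ∀ {n} (k : Fin (suc n)) i → merge k (unit i) ≡ unit (pinch k i)
merge-unit zero zero = refl
merge-unit zero (suc zero) = refl
merge-unit zero (suc (suc i)) = refl
merge-unit {suc n} (suc k) zero = cong (+ 1 ∷_) (map-0ᵛ (merge-linear k))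
merge-unit {suc n} (suc k) (suc i) = cong (+ 0 ∷_) (merge-unit k i)

merge-vec : ∀ {n} (k : Fin (suc n)) i j → merge k (vec (i , j)) ≡ vec (pinch k i , pinch k j)
merge-vec k i j = begin
  merge k (vec (i , j))                       ≡⟨ cong (merge k) (vec≡unit-unit i j) ⟩
  merge k (unit i -ᵛ unit j)                  ≡⟨ merge-subᵛ k (unit i) (unit j) ⟩
  merge k (unit i) -ᵛ merge k (unit j)        ≡⟨ cong₂ _-ᵛ_ (merge-unit k i) (merge-unit k j) ⟩
  unit (pinch k i) -ᵛ unit (pinch k j)        ≡⟨ sym (vec≡unit-unit _ _) ⟩
  vec (pinch k i , pinch k j)                 ∎
  where open ≡-Reasoning

duplicate : ∀ {n} → Fin (suc n) → Vec ℤ (suc n) → Vec ℤ (suc (suc n))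
duplicate zero (a ∷ cs) = a ∷ a ∷ cs
duplicate {suc n} (suc k) (a ∷ cs) = a ∷ duplicate k cs

duplicate-∙ : ∀ {n} (k : Fin (suc n)) c z → duplicate k c ∙ z ≡ c ∙ merge k z
duplicate-∙ zero (a ∷ cs) (x ∷ y ∷ zs) = ring a x y (cs ∙ zs)
  where
  ring : ∀ a x y u → a * x + (a * y + u) ≡ a * (x + y) + u
  ring = solve-∀
duplicate-∙ {suc n} (suc k) (a ∷ cs) (x ∷ zs) = cong (λ u → a * x + u) (duplicate-∙ k cs zs)

forget : ∀ {n} → Fin (suc n) → Vec ℤ (suc (suc n)) → Vec ℤ (suc n)
forget zero (a ∷ b ∷ cs) = a ∷ cs
forget {suc n} (suc k) (a ∷ cs) = a ∷ forget k cs

forget-∙-merge : ∀ {n} (k : Fin (suc n)) c z → lookup c (inject₁ k) ≡ lookup c (suc k) →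
  forget k c ∙ merge k z ≡ c ∙ z
forget-∙-merge zero (a ∷ b ∷ cs) (x ∷ y ∷ zs) refl = ring a x y (cs ∙ zs)
  where
  ring : ∀ a x y u → a * (x + y) + u ≡ a * x + (a * y + u)
  ring = solve-∀
forget-∙-merge {suc n} (suc k) (a ∷ cs) (x ∷ zs) eq = cong (λ u → a * x + u) (forget-∙-merge k cs zs eq)

indicator : ∀ {m} → (Fin m → Bool) → Vec ℤ m
indicator C = tabulate (λ v → if C v then + 1 else + 0)

-- Adding a multiple of the indicator of C leaves c unchanged on vectors orthogonal to that
-- indicator, and a suitable multiple equalises the entries of c at the two merged coordinates.
merge-push : ∀ {n} (k : Fin (suc n)) (C : Fin (suc (suc n)) → Bool) →
  C (inject₁ k) ≡ true → C (suc k) ≡ false →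
  ∀ c → ∃ λ c′ → ∀ z → indicator C ∙ z ≡ + 0 → c′ ∙ merge k z ≡ c ∙ z
merge-push k C k∈C k+1∉C c = forget k c″ , λ z z⊥C → begin
    forget k c″ ∙ merge k z               ≡⟨ forget-∙-merge k c″ z equalised ⟩
    c″ ∙ z                                ≡⟨ ∙-distribˡ-+ᵛ c (s *ᵛ indicator C) z ⟩
    c ∙ z + (s *ᵛ indicator C) ∙ z        ≡⟨ cong (λ u → c ∙ z + u) (∙-*ᵛˡ s (indicator C) z) ⟩
    c ∙ z + s * indicator C ∙ z           ≡⟨ cong (λ u → c ∙ z + s * u) z⊥C ⟩
    c ∙ z + s * + 0                       ≡⟨ cong (λ u → c ∙ z + u) (ℤₚ.*-zeroʳ s) ⟩
    c ∙ z + + 0                           ≡⟨ ℤₚ.+-identityʳ _ ⟩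
    c ∙ z                                 ∎
  where
  open ≡-Reasoning
  s = lookup c (suc k) - lookup c (inject₁ k)
  c″ = c +ᵛ s *ᵛ indicator C
  lookup-c″ : ∀ v → lookup c″ v ≡ lookup c v + s * (if C v then + 1 else + 0)
  lookup-c″ v = trans (Vecₚ.lookup-zipWith _+_ v c _)
    (cong (λ u → lookup c v + u) (trans (Vecₚ.lookup-map v (s *_) (indicator C))
      (cong (s *_) (Vecₚ.lookup∘tabulate (λ v → if C v then + 1 else + 0) v))))
  equalised : lookup c″ (inject₁ k) ≡ lookup c″ (suc k)
  equalised rewrite lookup-c″ (inject₁ k) | lookup-c″ (suc k) | k∈C | k+1∉C =
    ring (lookup c (suc k)) (lookup c (inject₁ k))
    where
    ring : ∀ a b → b + (a - b) * + 1 ≡ a + (a - b) * + 0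
    ring = solve-∀

pinch-<-mono : ∀ {n} (k : Fin (suc n)) {i j : Fin (suc (suc n))} → i Fin.< j →
  ¬ (i ≡ inject₁ k × j ≡ suc k) → pinch k i Fin.< pinch k j
pinch-<-mono zero {zero} {suc zero} i<j not-kk = ⊥-elim (not-kk (refl , refl))
pinch-<-mono zero {zero} {suc (suc j)} i<j not-kk = s≤s z≤n
pinch-<-mono zero {suc i} {suc j} (s≤s i<j) not-kk = i<j
pinch-<-mono {suc n} (suc k) {zero} {suc j} i<j not-kk = s≤s z≤n
pinch-<-mono {suc n} (suc k) {suc i} {suc j} (s≤s i<j) not-kk =
  s≤s (pinch-<-mono k i<j (λ { (refl , refl) → not-kk (refl , refl) }))

pinch-collision : ∀ {n} (k : Fin (suc n)) {a b : Fin (suc (suc n))} → pinch k a ≡ pinch k b → a ≡ b ⊎ pinch k a ≡ k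
pinch-collision zero {zero} {zero} eq = inj₁ refl
pinch-collision zero {zero} {suc b} eq = inj₂ refl
pinch-collision zero {suc a} {zero} eq = inj₂ eq
pinch-collision zero {suc a} {suc b} eq = inj₁ (cong suc eq)
pinch-collision {suc n} (suc k) {zero} {zero} eq = inj₁ refl
pinch-collision {suc n} (suc k) {suc a} {suc b} eq with pinch-collision k (Finₚ.suc-injective eq)
... | inj₁ a≡b = inj₁ (cong suc a≡b)
... | inj₂ pinch≡k = inj₂ (cong suc pinch≡k)

pinch≡k : ∀ {n} (k : Fin (suc n)) {a : Fin (suc (suc n))} → pinch k a ≡ k → a ≡ inject₁ k ⊎ a ≡ suc k
pinch≡k zero {zero} eq = inj₁ refl
pinch≡k zero {suc a} eq = inj₂ (cong suc eq)
pinch≡k {suc n} (suc k) {suc a} eq with pinch≡k k (Finₚ.suc-injective eq)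
... | inj₁ a≡k = inj₁ (cong suc a≡k)
... | inj₂ a≡k+1 = inj₂ (cong suc a≡k+1)

-- Identifying the coordinates k and k + 1, which lie in different unions C of components
-- of the graph of V, does not change the combinatorial type: the merge map is injective on
-- the span of V because that span is orthogonal to the indicator of C.
module Merge {n} (V : GenSet (suc n)) (k : Fin (suc n)) (C : Fin (suc (suc n)) → Bool)
  (k∈C : C (inject₁ k) ≡ true) (k+1∉C : C (suc k) ≡ false)
  (closed : ∀ i j → (i , j) ∈ gens V → C i ≡ C j) where

  pinch-edge : Pair (suc n) → Pair n
  pinch-edge (i , j) = pinch k i , pinch k j

  separated : C (inject₁ k) ≢ C (suc k)
  separated eq with trans (sym k∈C) (trans eq k+1∉C)
  ... | ()

  not-merged-edge : ∀ {i j} → (i , j) ∈ gens V → ¬ (i ≡ inject₁ k × j ≡ suc k)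
  not-merged-edge e∈ (refl , refl) = separated (closed _ _ e∈)

  pinch-edge-< : ∀ {i j} → (i , j) ∈ gens V → pinch k i Fin.< pinch k j
  pinch-edge-< e∈ = pinch-<-mono k (All.lookup (ordered V) e∈) (not-merged-edge e∈)

  pinch-injective-across : ∀ {a b} → pinch k a ≡ pinch k b → C a ≡ C b → a ≡ b
  pinch-injective-across {a} {b} eq same-side with pinch-collision k eq
  ... | inj₁ a≡b = a≡b
  ... | inj₂ a↦k with pinch≡k k {a} a↦k | pinch≡k k {b} (trans (sym eq) a↦k)
  ...   | inj₁ refl | inj₁ refl = refl
  ...   | inj₂ refl | inj₂ refl = refl
  ...   | inj₁ refl | inj₂ refl = ⊥-elim (separated same-side)
  ...   | inj₂ refl | inj₁ refl = ⊥-elim (separated (sym same-side))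

  pinch-edge-injective : ∀ {e e′} → e ∈ gens V → e′ ∈ gens V → pinch-edge e ≡ pinch-edge e′ → e ≡ e′
  pinch-edge-injective {i , j} {i′ , j′} e∈ e′∈ eq with C i Boolₚ.≟ C i′
  ... | yes same = cong₂ _,_ (pinch-injective-across (cong proj₁ eq) same)
    (pinch-injective-across (cong proj₂ eq) (trans (sym (closed i j e∈)) (trans same (closed i′ j′ e′∈))))
  ... | no differ = ⊥-elim (Finₚ.<-irrefl (trans i↦k (sym j↦k)) (pinch-edge-< e∈))
    where
    i↦k : pinch k i ≡ k
    i↦k with pinch-collision k {i} {i′} (cong proj₁ eq)
    ... | inj₁ refl = ⊥-elim (differ refl)
    ... | inj₂ pinch≡k = pinch≡k
    j↦k : pinch k j ≡ k
    j↦k with pinch-collision k {j} {j′} (cong proj₂ eq)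
    ... | inj₁ refl = ⊥-elim (differ (trans (closed i j e∈) (sym (closed i′ j e′∈))))
    ... | inj₂ pinch≡k = pinch≡k

  merged : GenSet n
  merged = genSet (List.map pinch-edge (gens V))
    (Allₚ.map⁺ (All.tabulate λ { {i , j} → pinch-edge-< }))
    (Unique-map⁺ pinch-edge (gens V) (unique V) pinch-edge-injective)

  merged-vectors : vectors merged ≡ List.map (merge k) (vectors V)
  merged-vectors = trans (sym (Listₚ.map-∘ (gens V)))
    (trans (Listₚ.map-cong (λ { (i , j) → sym (merge-vec k i j) }) (gens V)) (Listₚ.map-∘ (gens V)))

  indicator-⊥-vectors : ∀ v → v ∈ vectors V → indicator C ∙ v ≡ + 0
  indicator-⊥-vectors v v∈ with ∈-map⁻ vec v∈
  ... | (i , j) , e∈ , refl rewrite ∙-vec (indicator C) i j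
        | Vecₚ.lookup∘tabulate (λ v → if C v then + 1 else + 0) i
        | Vecₚ.lookup∘tabulate (λ v → if C v then + 1 else + 0) j
        | closed i j e∈ = ℤₚ.+-inverseʳ (if C j then + 1 else + 0)

  merge-injective-⊥ : ∀ z → indicator C ∙ z ≡ + 0 → merge k z ≡ 0ᵛ _ → z ≡ 0ᵛ _
  merge-injective-⊥ z z⊥C merge≡0 = vec-ext λ i → let c′ , agree = merge-push k C k∈C k+1∉C (unit i) in
    trans (sym (unit-∙ i z)) (trans (sym (agree z z⊥C)) (trans (cong (c′ ∙_) merge≡0)
      (trans (∙-zeroʳ c′) (sym (Vecₚ.lookup-replicate i (+ 0))))))

  LinIndep-merge : ∀ Ls → Ls ⊆ vectors V → LinIndep Ls → LinIndep (List.map (merge k) Ls)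
  LinIndep-merge Ls Ls⊆ indep ν ν-kills = coeffs⁻-zero-inv (merge k) Ls ν (indep _
    (trans (lincomb≡linComb Ls _) (merge-injective-⊥ _
      (∙-linComb-annihilated (indicator C) Ls _ (λ v v∈ → indicator-⊥-vectors v (Sublist.lookup Ls⊆ v∈)))
      (trans (sym (linComb-map (merge-linear k) Ls ν))
        (trans (sym (lincomb≡linComb (List.map (merge k) Ls) ν)) ν-kills)))))

  LinIndep-unmerge : ∀ Ls → LinIndep (List.map (merge k) Ls) → LinIndep Ls
  LinIndep-unmerge Ls indep μ μ-kills = coeffs⁺-zero-inv (merge k) Ls μ (indep _
    (trans (lincomb≡linComb (List.map (merge k) Ls) _) (trans (linComb-map⁺ (merge-linear k) Ls μ)
      (trans (cong (merge k) (trans (sym (lincomb≡linComb Ls μ)) μ-kills)) (map-0ᵛ (merge-linear k))))))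

  merged-HasDim : ∀ {d} → HasDim V d → HasDim merged d
  merged-HasDim ((Ls , Ls⊆ , length≡d , indep) , maximal) =
    (List.map (merge k) Ls , subst (List.map (merge k) Ls ⊆_) (sym merged-vectors) (Sublistₚ.map⁺ (merge k) Ls⊆) ,
      trans (Listₚ.length-map (merge k) Ls) length≡d , LinIndep-merge Ls Ls⊆ indep) ,
    λ Ks Ks⊆ length≡1+d → maximal′ (⊆-map⁻ (merge k) (vectors V) (subst (Ks ⊆_) merged-vectors Ks⊆)) length≡1+d
    where
    maximal′ : ∀ {Ks} → (∃ λ Ls → Ls ⊆ vectors V × Ks ≡ List.map (merge k) Ls) → length Ks ≡ suc _ → ¬ LinIndep Ks
    maximal′ (Ls , Ls⊆ , refl) length≡1+d indep =
      maximal Ls Ls⊆ (trans (sym (Listₚ.length-map (merge k) Ls)) length≡1+d) (LinIndep-unmerge Ls indep)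

  sumVecs-merge : ∀ S → sumVecs (List.map (merge k) S) ≡ merge k (sumVecs S)
  sumVecs-merge [] = sym (map-0ᵛ (merge-linear k))
  sumVecs-merge (v ∷ S) = trans (cong (merge k v ⊕_) (sumVecs-merge S)) (sym (Linear.map-+ᵛ (merge-linear k) v (sumVecs S)))

  merged-sums : SubsetSums merged ≡ List.map (merge k) (SubsetSums V)
  merged-sums = begin
    List.map sumVecs (subs (vectors merged))   ≡⟨ cong (λ vs → List.map sumVecs (subs vs)) merged-vectors ⟩
    List.map sumVecs (subs (List.map (merge k) (vectors V)))      ≡⟨ cong (List.map sumVecs) (subs-map (merge k) (vectors V)) ⟩
    List.map sumVecs (List.map (List.map (merge k)) (subs (vectors V))) ≡⟨ sym (Listₚ.map-∘ (subs (vectors V))) ⟩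
    List.map (λ S → sumVecs (List.map (merge k) S)) (subs (vectors V)) ≡⟨ Listₚ.map-cong sumVecs-merge (subs (vectors V)) ⟩
    List.map (λ S → merge k (sumVecs S)) (subs (vectors V))       ≡⟨ Listₚ.map-∘ (subs (vectors V)) ⟩
    List.map (merge k) (SubsetSums V)                      ∎
    where open ≡-Reasoning

  indicator-⊥-sums : ∀ p → p ∈ SubsetSums V → indicator C ∙ p ≡ + 0
  indicator-⊥-sums p p∈ with ∈-map⁻ sumVecs p∈
  ... | S , S∈ , refl = ⊥-sum S (∈-subs (vectors V) S∈)
    where
    ⊥-sum : ∀ S → (∀ {v} → v ∈ S → v ∈ vectors V) → indicator C ∙ sumVecs S ≡ + 0
    ⊥-sum [] _ = ∙-zeroʳ (indicator C)
    ⊥-sum (v ∷ S) S⊆ rewrite ∙-distribʳ-+ᵛ (indicator C) v (sumVecs S)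
      | indicator-⊥-vectors v (S⊆ (here refl)) | ⊥-sum S (λ v∈ → S⊆ (there v∈)) = refl

  merged-SumsIso : SumsIso V merged
  merged-SumsIso = record
    { φ = merge k
    ; sums-image = merged-sums
    ; push = λ c → let c′ , agree = merge-push k C k∈C k+1∉C c in c′ , λ p p∈ → agree p (indicator-⊥-sums p p∈)
    ; pull = λ c′ → duplicate k c′ , λ p _ → sym (duplicate-∙ k c′ p)
    }

-- Exploring the component of the first vertex

module Exploration {n} (V : GenSet n) where

  Closed : (Fin (suc n) → Bool) → Set
  Closed S = ∀ i j → (i , j) ∈ gens V → S i ≡ S j

  -- S is the explored set and tree the edge vectors of a spanning tree of S.
  record Explored : Set where
    field
      S : Fin (suc n) → Bool
      root∈S : S zero ≡ true
      tree : List (Pt n)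
      tree⊆vectors : tree ⊆ vectors V
      tree-indep : LinIndep tree
      tree-size : suc (length tree) ≡ count S
      tree-inside : ∀ x → x ∈ tree → ∀ w → S w ≡ false → lookup x w ≡ + 0
      reachable : ∀ v → S v ≡ true → Reach V zero v

  record Crossing (S : Fin (suc n) → Bool) : Set where
    field
      u w : Fin (suc n)
      u∈S : S u ≡ true
      w∉S : S w ≡ false
      u⇝w : Reach V u w
      y : Pt n
      y∈vectors : y ∈ vectors V
      y-at-w : lookup y w ≢ + 0
      y-support : ∀ v → v ≢ u → v ≢ w → lookup y v ≡ + 0

  edge-crossing : ∀ {S i j} → (i , j) ∈ gens V → S i ≢ S j → Crossing S
  edge-crossing {S} {i} {j} e∈ differ with S i in Si | S j in Sj
  ... | true | true = ⊥-elim (differ refl)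
  ... | false | false = ⊥-elim (differ refl)
  ... | true | false = record
    { u = i ; w = j ; u∈S = Si ; w∉S = Sj ; u⇝w = stepF e∈ here ; y = vec (i , j) ; y∈vectors = ∈-map⁺ vec e∈
    ; y-at-w = λ eq → case (trans (sym (lookup-vec-target i≢j)) eq)
    ; y-support = vec-support i j
    }
    where
    i≢j = Finₚ.<⇒≢ (All.lookup (ordered V) e∈)
    case : ¬ (-[1+ 0 ] ≡ + 0)
    case ()
  ... | false | true = record
    { u = j ; w = i ; u∈S = Sj ; w∉S = Si ; u⇝w = stepB e∈ here ; y = vec (i , j) ; y∈vectors = ∈-map⁺ vec e∈
    ; y-at-w = λ eq → case (trans (sym (lookup-vec-source i≢j)) eq)
    ; y-support = λ v v≢j v≢i → vec-support i j v v≢i v≢j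
    }
    where
    i≢j = Finₚ.<⇒≢ (All.lookup (ordered V) e∈)
    case : ¬ (+ 1 ≡ + 0)
    case ()

  crossing-or-closed : ∀ S → Crossing S ⊎ Closed S
  crossing-or-closed S with All.all? (λ e → S (proj₁ e) Boolₚ.≟ S (proj₂ e)) (gens V)
  ... | yes closed = inj₂ λ i j e∈ → All.lookup closed e∈
  ... | no ¬closed with find (Allₚ.¬All⇒Any¬ (λ e → S (proj₁ e) Boolₚ.≟ S (proj₂ e)) (gens V) ¬closed)
  ...   | (i , j) , e∈ , differ = inj₁ (edge-crossing e∈ differ)

  start : Explored
  start = record
    { S = root-only ; root∈S = refl ; tree = [] ; tree⊆vectors = Sublist.minimum (vectors V)
    ; tree-indep = λ { [] _ → refl } ; tree-size = cong suc (sym (count-none n))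
    ; tree-inside = λ _ () ; reachable = λ { zero _ → here }
    }
    where
    root-only : Fin (suc n) → Bool
    root-only zero = true
    root-only (suc _) = false

  module Extend (e : Explored) (crossing : Crossing (Explored.S e)) where
    open Explored e
    open Crossing crossing

    S′ : Fin (suc n) → Bool
    S′ v = S v ∨ does (v Fin.≟ w)

    S′-w : S′ w ≡ true
    S′-w with w Fin.≟ w
    ... | yes _ = Boolₚ.∨-zeroʳ (S w)
    ... | no w≢w = ⊥-elim (w≢w refl)

    S′-≢ : ∀ {v} → v ≢ w → S′ v ≡ S v
    S′-≢ {v} v≢w with v Fin.≟ w
    ... | yes v≡w = ⊥-elim (v≢w v≡w)
    ... | no _ = Boolₚ.∨-identityʳ (S v)

    y∉tree : ¬ (y ∈ tree)
    y∉tree y∈ = y-at-w (tree-inside y y∈ w w∉S)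

    inserted = insert-⊆ tree⊆vectors y∈vectors y∉tree
    As = proj₁ inserted
    Bs = proj₁ (proj₂ inserted)
    tree≡ : tree ≡ As ++ Bs
    tree≡ = proj₁ (proj₂ (proj₂ inserted))

    tree′-indep : LinIndep (As ++ y ∷ Bs)
    tree′-indep = LinIndep-insert As Bs y (unit w) (subst LinIndep tree≡ tree-indep)
      (λ x x∈ → trans (unit-∙ w x) (tree-inside x (subst (x ∈_) (sym tree≡) x∈) w w∉S))
      (λ eq → y-at-w (trans (sym (unit-∙ w y)) eq))

    outside : ∀ {v} → S′ v ≡ false → v ≢ w × S v ≡ false
    outside v∉S′ = v≢w , trans (sym (S′-≢ v≢w)) v∉S′
      where
      v≢w : _ ≢ w
      v≢w refl = Boolₚ.not-¬ S′-w v∉S′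

    inside : ∀ v → S′ v ≡ true → v ≡ w ⊎ S v ≡ true
    inside v with S v | v Fin.≟ w
    ... | true | _ = λ _ → inj₂ refl
    ... | false | yes v≡w = λ _ → inj₁ v≡w
    ... | false | no _ = λ ()

    tree′-inside : ∀ x → x ∈ As ++ y ∷ Bs → ∀ v → S′ v ≡ false → lookup x v ≡ + 0
    tree′-inside x x∈ v v∉S′ with outside v∉S′ | ∈-insert⁻ As x∈
    ... | _ , v∉S | inj₁ x∈tree = tree-inside x (subst (x ∈_) (sym tree≡) x∈tree) v v∉S
    ... | v≢w , v∉S | inj₂ refl = y-support v (λ { refl → Boolₚ.not-¬ u∈S v∉S }) v≢w

    reachable′ : ∀ v → S′ v ≡ true → Reach V zero v
    reachable′ v v∈S′ with inside v v∈S′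
    ... | inj₁ refl = Reach-trans (reachable u u∈S) u⇝w
    ... | inj₂ v∈S = reachable v v∈S

    count-S′ : count S′ ≡ suc (count S)
    count-S′ = count-insert S S′ w w∉S S′-w (λ v → S′-≢)

    explored′ : Explored
    explored′ = record
      { S = S′ ; root∈S = cong (_∨ _) root∈S ; tree = As ++ y ∷ Bs ; tree⊆vectors = proj₂ (proj₂ (proj₂ inserted))
      ; tree-indep = tree′-indep
      ; tree-size = begin
          suc (length (As ++ y ∷ Bs))  ≡⟨ cong suc (length-insert As) ⟩
          suc (suc (length (As ++ Bs))) ≡⟨ cong (λ t → suc (suc (length t))) (sym tree≡) ⟩
          suc (suc (length tree))      ≡⟨ cong suc tree-size ⟩
          suc (count S)                ≡⟨ sym count-S′ ⟩
          count S′                     ∎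
      ; tree-inside = tree′-inside ; reachable = reachable′
      }
      where open ≡-Reasoning

  explore : ∀ fuel (e : Explored) → count (Explored.S e) ℕ.+ fuel ≡ suc (suc n) →
    Σ Explored λ e → Closed (Explored.S e)
  explore zero e size≡ = ⊥-elim (ℕₚ.<-irrefl refl (ℕₚ.≤-trans (s≤s (count-≤ S))
    (ℕₚ.≤-reflexive (trans (sym size≡) (ℕₚ.+-identityʳ _)))))
    where open Explored e
  explore (suc fuel) e size≡ with crossing-or-closed (Explored.S e)
  ... | inj₂ closed = e , closed
  ... | inj₁ crossing = explore fuel (Extend.explored′ e crossing)
    (trans (cong (ℕ._+ fuel) (Extend.count-S′ e crossing)) (trans (sym (ℕₚ.+-suc _ fuel)) size≡))

  exploration : Σ Explored λ e → Closed (Explored.S e)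
  exploration = explore (suc n) start (cong (ℕ._+ suc n) (sym (Explored.tree-size start)))

module _ {n} (V : GenSet n) {d} (hasDim : HasDim V d) where

  spanning⇒≤dim : ∀ {T} → T ⊆ vectors V → LinIndep T → length T ≡ n → n ≤ d
  spanning⇒≤dim {T} T⊆ indep length≡n = ℕₚ.≮⇒≥ λ d<n →
    proj₂ hasDim (List.take (suc d) T) (Sublist.⊆-trans (Sublistₚ.take-⊆ (suc d) T) T⊆)
      (trans (Listₚ.length-take (suc d) T) (ℕₚ.m≤n⇒m⊓n≡m (subst (d ℕ.<_) (sym length≡n) d<n)))
      (LinIndep-⊆ (Sublistₚ.take-⊆ (suc d) T) indep)

  dim≤ : d ≤ n
  dim≤ with proj₁ hasDim
  ... | Ls , Ls⊆ , length≡d , indep = ℕₚ.≮⇒≥ λ n<d → Dependent⇒¬LinIndep {vs = Ls}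
    (sum-zero⇒Dependent Ls (λ v v∈ → 1ᵛ-⊥-vectors V (Sublist.lookup Ls⊆ v∈))
      (subst (n ℕ.<_) (sym length≡d) n<d)) indep

connected-model : ∀ {n} (V : GenSet n) {d} → HasDim V d → Σ (GenSet d) λ V′ → Connected V′ × SumsIso V V′
connected-model {n} V {d} hasDim with Exploration.exploration V
... | e , closed with full-or-boundary (Exploration.Explored.S e) (Exploration.Explored.root∈S e)
...   | inj₁ full = subst (λ m → Σ (GenSet m) λ V′ → Connected V′ × SumsIso V V′) n≡d (V , connected , SumsIso-refl V)
  where
  open Exploration.Explored e
  connected : Connected V
  connected i j = Reach-trans (Reach-sym (reachable i (full i))) (reachable j (full j))
  n≡d : n ≡ d
  n≡d = ℕₚ.≤-antisym (spanning⇒≤dim V hasDim tree⊆vectors tree-indep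
          (ℕₚ.suc-injective (trans tree-size (count-all S full)))) (dim≤ V hasDim)
connected-model {suc n} V hasDim | e , closed | inj₂ (k , k∈S , k+1∉S) =
  let V′ , connected , iso = connected-model merged (merged-HasDim hasDim) in
  V′ , connected , SumsIso-trans merged-SumsIso iso
  where open Merge V k (Exploration.Explored.S e) k∈S k+1∉S closed

mainTheorem6 : (n d : ℕ) (V : GenSet n) → HasDim V d →
    Σ (GenSet d) (λ V' → Connected V' × CombEquiv V V')
mainTheorem6 n d V hasDim =
  let V′ , connected , iso = connected-model V hasDim in V′ , connected , SumsIso⇒CombEquiv iso
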